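{- Let $N\ge 1$ and let $U(\mathfrak{gl}_N)$ be the universal enveloping algebra (over $\mathbb{C}$) of the Lie algebra $\mathfrak{gl}_N$ of all $N\times N$ complex matrices, with matrix units $E_{ij}$, $1\le i,j\le N$. For a finite totally ordered set $X$ and a bijection $\rho:X\to X$ put \[ w_{\mathfrak{gl}_N}(\rho)=\sum_{i:X\to\{1,\dots,N\}}\ \prod_{x\in X}^{\rightarrow} E_{i_x\, i_{\rho(x)}}\in U(\mathfrak{gl}_N), \] where the product is taken over the elements of $X$ in increasing order (for $X=\emptyset$ the product is $1$); in particular, for $\sigma\in S_m$ (a permutation of $\{1,\dots,m\}$ with its usual order) $w_{\mathfrak{gl}_N}(\sigma)=\sum_{i_1,\dots,i_m=1}^N E_{i_1 i_{\sigma(1)}}\cdots E_{i_m i_{\sigma(m)}}$. For $k\ge1$ let $C_k=\sum_{i_1,\dots,i_k=1}^N E_{i_1i_2}E_{i_2i_3}\cdots E_{i_ki_1}$. Then: (1) for the empty permutation ($m=0$), $w_{\mathfrak{gl}_N}=1$; (2) $w_{\mathfrak{gl}_N}$ is multiplicative under concatenation: for $\sigma\in S_m$, $\tau\in S_l$, letting $\sigma\sqcup\tau\in S_{m+l}$ be defined by $(\sigma\sqcup\tau)(j)=\sigma(j)$ for $j\le m$ and $(\sigma\sqcup\tau)(j)=m+\tau(j-m)$ for $j>m$, one has $w_{\mathfrak{gl}_N}(\sigma\sqcup\tau)=w_{\mathfrak{gl}_N}(\sigma)\,w_{\mathfrak{gl}_N}(\tau)$; (3) for the cyclic permutation $1\mapsto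 2\mapsto\cdots\mapsto k\mapsto 1$ in $S_k$, $w_{\mathfrak{gl}_N}$ equals $C_k$; (4) (Recurrence rule) Let $m\ge2$, $\sigma\in S_m$, $1\le k\le m-1$, let $s=(k\ k{+}1)$ be the transposition and $\tau=\sigma\circ s$. For a bijection $\rho$ of a finite set $X$ and $j\in X$ with $\rho(j)\ne j$, let $\rho^{\setminus j}$ be the bijection of $X\setminus\{j\}$ given by $\rho^{\setminus j}(\rho^{ -1}(j))=\rho(j)$ and $\rho^{\setminus j}(x)=\rho(x)$ for all other $x$. (a) If $\sigma(k)\ne k+1$ and $\sigma(k+1)\ne k$, then \[ w_{\mathfrak{gl}_N}(\sigma)-w_{\mathfrak{gl}_N}(s\sigma s)=w_{\mathfrak{gl}_N}\big(\tau^{\setminus (k+1)}\big)-w_{\mathfrak{gl}_N}\big(\tau^{\setminus k}\big), \] where $\tau^{\setminus(k+1)}$ and $\tau^{\setminus k}$ are bijections of $\{1,\dots,m\}\setminus\{k+1\}$ and $\{1,\dots,m\}\setminus\{k\}$ with the induced order. Explicitly, with $a=\sigma^{ -1}(k+1)$, $b=\sigma^{ -1}(k)$, $c=\sigma(k)$, $d=\sigma(k+1)$ (all outside $\{k,k+1\}$ in the generic situation), $\tau^{\setminus(k+1)}$ sends $a\mapsto c$, $k\mapsto d$ and agrees with $\sigma$ elsewhere, while $\tau^{\setminus k}$ sends $b\mapsto d$, $k+1\mapsto c$ and agrees with $\sigma$ elsewhere. (b) If $\sigma(k+1)=k$ and $a=\sigma^{ -1}(k+1)$, $b=\sigma(k)$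 both lie outside $\{k,k+1\}$, then \[ w_{\mathfrak{gl}_N}(\sigma)-w_{\mathfrak{gl}_N}(s\sigma s)=C_1\, w_{\mathfrak{gl}_N}(\rho_0)-N\, w_{\mathfrak{gl}_N}(\rho_2), \] where $\rho_0$ is the bijection of $\{1,\dots,m\}\setminus\{k,k+1\}$ with $\rho_0(a)=b$ and $\rho_0(x)=\sigma(x)$ otherwise, and $\rho_2$ is the bijection of $\{1,\dots,m\}\setminus\{k\}$ with $\rho_2(a)=k+1$, $\rho_2(k+1)=b$ and $\rho_2(x)=\sigma(x)$ otherwise (both sets carrying the induced order).
   Context: $\mathfrak{gl}_N$ is equipped with the commutator bracket, so $[E_{kl},E_{ji}]=\delta_{lj}E_{ki}-\delta_{ik}E_{jl}$. The elements $C_k$ ($k\ge1$) are the Casimir elements of $U(\mathfrak{gl}_N)$. In the paper the recurrence is stated pictorially on the digraph of the permutation (vertices $1,\dots,m$, an arrow $x\to\sigma(x)$ for each $x$), with two neighbouring vertices $k,k+1$ merged into one vertex; the formulas above are the corresponding identities. -}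

module Defs where

open import Level using (Level)
open import Algebra.Bundles using (Ring)
open import Data.Nat using (ℕ; zero; suc; _≤_) renaming (_+_ to _+ℕ_)
open import Data.Fin using (Fin; zero; suc; inject₁; punchIn; punchOut; splitAt; join; _≟_; fromℕ; lower₁)
open import Data.Fin.Permutation using (Permutation′; _⟨$⟩ʳ_; _⟨$⟩ˡ_)
import Data.Fin.Permutation.Components as PC
open import Data.Sum using (_⊎_; inj₁; inj₂)
import Data.Sum as Sum
open import Data.Product using (_×_)
open import Relation.Nullary using (yes; no; ¬_)
open import Relation.Binary.PropositionalEquality using (_≡_; _≢_)

-- Combinatorics of permutations (paper's indices 1..m are Fin m, 0-based)

consF : ∀ {n} {A : Set} → A → (Fin n → A) → Fin (suc n) → A
consF a f zero    = a
consF a f (suc x) = f x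

swapF : ∀ {m} → Fin m → Fin m → Fin m → Fin m
swapF = PC.transpose

-- ρ^{\ j}: for ρ a bijection of X = Fin (suc n) and j with ρ j ≢ j,
-- the bijection of X \ {j}; X \ {j} (with induced order) is identified
-- with Fin n via the order-preserving embedding  punchIn j.
-- ρ^{\ j}(ρ⁻¹(j)) = ρ(j),  ρ^{\ j}(x) = ρ(x) otherwise.
-- (The last clause is junk, only reached when ρ j ≡ j, which the
--  theorem always excludes by hypothesis.)
removeAt : ∀ {n} → (Fin (suc n) → Fin (suc n)) → Fin (suc n) → Fin n → Fin n
removeAt ρ j x with j ≟ ρ (punchIn j x)
... | no ne = punchOut ne
... | yes _ with j ≟ ρ j
...   | no ne = punchOut ne
...   | yes _ = x

concatF : ∀ {m l} → (Fin m → Fin m) → (Fin l → Fin l) → Fin (m +ℕ l) → Fin (m +ℕ l)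
concatF {m} {l} σ τ j = join m l (Sum.map σ τ (splitAt m j))

cycleF : ∀ k → Fin k → Fin k
cycleF (suc k) x with x Data.Fin.≟ fromℕ k
... | yes _ = zero
... | no ne = suc (lower₁ x (λ eq → ne (helper eq)))
  where
  open import Data.Fin.Properties using (toℕ-fromℕ; toℕ-injective)
  open import Relation.Binary.PropositionalEquality using (sym; trans)
  helper : k ≡ Data.Fin.toℕ x → x ≡ fromℕ k
  helper eq = toℕ-injective (trans (sym eq) (sym (toℕ-fromℕ k)))

-- Algebra: U(gl_N) is described through its universal property: the
-- theorem is stated in an arbitrary (associative, unital) ring R with
-- elements E i j satisfying the gl_N commutation relations.

module GL {c ℓ : Level} (R : Ring c ℓ) (N : ℕ) where
  open Ring R using (Carrier; _≈_; _+_; _*_; _-_; 0#; 1#)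

  δ : Fin N → Fin N → Carrier
  δ a b with a ≟ b
  ... | yes _ = 1#
  ... | no _  = 0#

  IsGLFamily : (Fin N → Fin N → Carrier) → Set ℓ
  IsGLFamily E = ∀ k l j i →
    (E k l * E j i) - (E j i * E k l) ≈ (δ l j * E k i) - (δ i k * E j l)

  sumN : (Fin N → Carrier) → Carrier
  sumN = go N (λ x → x)
    where
    go : ∀ n → (Fin n → Fin N) → (Fin N → Carrier) → Carrier
    go zero    emb f = 0#
    go (suc n) emb f = f (emb zero) + go n (λ x → emb (suc x)) f

  sumAssign : ∀ n → ((Fin n → Fin N) → Carrier) → Carrier
  sumAssign zero    F = F (λ ())
  sumAssign (suc n) F = sumN (λ a → sumAssign n (λ i → F (consF a i)))

  prodOrd : ∀ n → (Fin n → Carrier) → Carrier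
  prodOrd zero    f = 1#
  prodOrd (suc n) f = f zero * prodOrd n (λ x → f (suc x))

  natMul : ℕ → Carrier → Carrier
  natMul zero    x = 0#
  natMul (suc n) x = x + natMul n x

  module _ (E : Fin N → Fin N → Carrier) where

    w : ∀ {n} → (Fin n → Fin n) → Carrier
    w {n} ρ = sumAssign n (λ i → prodOrd n (λ x → E (i x) (i (ρ x))))

    C : ℕ → Carrier
    C k = sumAssign k (λ i → prodOrd k (λ x → E (i x) (i (cycleF k x))))

    Part1 : Set ℓ
    Part1 = (σ : Permutation′ 0) → w (σ ⟨$⟩ʳ_) ≈ 1#

    Part2 : Set ℓ
    Part2 = ∀ m l (σ : Permutation′ m) (τ : Permutation′ l) →
      w (concatF (σ ⟨$⟩ʳ_) (τ ⟨$⟩ʳ_)) ≈ w (σ ⟨$⟩ʳ_) * w (τ ⟨$⟩ʳ_)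

    Part3 : Set ℓ
    Part3 = ∀ k → 1 ≤ k → w (cycleF k) ≈ C k

    -- m = n + 2 ≥ 2; paper's k ∈ {1..m-1} is k : Fin (suc n);
    -- paper's k and k+1 are  inject₁ k  and  suc k.
    Part4a : Set ℓ
    Part4a = ∀ n (σ : Permutation′ (suc (suc n))) (k : Fin (suc n)) →
      let kA = inject₁ k
          kB = suc k
          σf = σ ⟨$⟩ʳ_
          s  = swapF kA kB
          τ  = λ x → σf (s x)
      in σf kA ≢ kB → σf kB ≢ kA →
         w σf - w (λ x → s (σf (s x))) ≈ w (removeAt τ kB) - w (removeAt τ kA)

    Part4b : Set ℓ
    Part4b = ∀ n (σ : Permutation′ (suc (suc n))) (k : Fin (suc n)) →
      let kA = inject₁ k
          kB = suc k
          σf = σ ⟨$⟩ʳ_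
          s  = swapF kA kB
          a  = σ ⟨$⟩ˡ kB
          b  = σf kA
          -- ρ₂ = σ^{\ k}: on {1..m}∖{k}, a ↦ k+1, k+1 ↦ b, else σ
          ρ₂ = removeAt σf kA
          -- ρ₀: on {1..m}∖{k,k+1}, a ↦ b, else σ   ( = (σ^{\ k})^{\ k+1} ;
          -- k+1 has index k in {1..m}∖{k} ≅ Fin (suc n) )
          ρ₀ = removeAt ρ₂ k
      in σf kB ≡ kA →
         a ≢ kA → a ≢ kB → b ≢ kA → b ≢ kB →
         w σf - w (λ x → s (σf (s x))) ≈ (C 1 * w ρ₀) - natMul N (w ρ₂)

    Theorem : Set ℓ
    Theorem = Part1 × Part2 × Part3 × Part4a × Part4b

-- Expand both sides as sums over assignments i of colours in {1..N} to the vertices.  After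
-- relabelling the assignments by s, the monomials of σ and of sσs differ only in the order of the
-- two adjacent factors at k and k+1, so their difference is the commutator of these factors
-- sandwiched between the remaining ones.  The gl_N relation turns it into two terms, each carrying
-- a Kronecker delta that identifies the colour of a vertex with the colour of its image; summing
-- out the colour of that vertex deletes it and joins its incoming and outgoing arrows, which gives
-- the monomials of the contracted bijections τ^{\ k+1} and τ^{\ k}.  In case (b) one delta is
-- identically 1 and the free colour contributes a factor N, while the other term keeps a loop
-- E_{aa}; summed over a it is C₁, which commutes with every E_{pq} and so moves to the front.
module Submission where

open import Defs
open import Level using (Level)
open import Algebra.Bundles using (Ring)
open import Data.Nat.Base as ℕ using (ℕ; zero; suc; _≤_)
open import Data.Fin.Base using (Fin; zero; suc; inject₁; punchIn; punchOut; _↑ˡ_; _↑ʳ_; splitAt)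
open import Data.Fin.Properties
  using (_≟_; punchIn-injective; punchInᵢ≢i; punchIn-punchOut; splitAt-↑ˡ; splitAt-↑ʳ)
open import Data.Fin.Permutation as Perm using (Permutation′; _⟨$⟩ʳ_)
import Data.Fin.Permutation.Components as PC
open import Data.Vec.Functional using (insertAt; _++_)
open import Data.Vec.Functional.Properties
  using (insertAt-lookup; insertAt-punchIn; lookup-++ˡ; lookup-++ʳ)
import Data.Sum as Sum
open import Data.Product using (∃₂; _,_)
open import Data.Empty using (⊥-elim)
open import Function.Base using (_∘_)
open import Function.Bundles using (Injection)
open import Function.Properties.Inverse using (↔⇒↣)
open import Relation.Nullary using (yes; no)
open import Relation.Binary.Core using (_Preserves_⟶_)
open import Relation.Binary.PropositionalEquality
  using (_≡_; _≢_; _≗_; refl; sym; trans; cong; cong₂)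

transpose-applyˡ : ∀ {n} (i j : Fin n) → PC.transpose i j i ≡ j
transpose-applyˡ i j with i ≟ i
... | yes _ = refl
... | no i≢i = ⊥-elim (i≢i refl)

transpose-applyʳ : ∀ {n} (i j : Fin n) → PC.transpose i j j ≡ i
transpose-applyʳ i j with j ≟ i
... | yes j≡i = j≡i
... | no _ with j ≟ j
...   | yes _ = refl
...   | no j≢j = ⊥-elim (j≢j refl)

transpose-fix : ∀ {n} {i j k : Fin n} → k ≢ i → k ≢ j → PC.transpose i j k ≡ k
transpose-fix {i = i} {j} {k} k≢i k≢j with k ≟ i
... | yes k≡i = ⊥-elim (k≢i k≡i)
... | no _ with k ≟ j
...   | yes k≡j = ⊥-elim (k≢j k≡j)
...   | no _ = refl

transpose-involutive : ∀ {n} (i j k : Fin n) → PC.transpose i j (PC.transpose i j k) ≡ k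
transpose-involutive i j k with k ≟ i
... | yes refl = transpose-applyʳ i j
... | no k≢i with k ≟ j
...   | yes refl = transpose-applyˡ i j
...   | no k≢j = transpose-fix k≢i k≢j

punchIn-suc-self : ∀ {n} (k : Fin (suc n)) → punchIn (suc k) k ≡ inject₁ k
punchIn-suc-self zero = refl
punchIn-suc-self {suc n} (suc k) = cong suc (punchIn-suc-self k)

punchIn-inject₁-self : ∀ {n} (k : Fin (suc n)) → punchIn (inject₁ k) k ≡ suc k
punchIn-inject₁-self zero = refl
punchIn-inject₁-self {suc n} (suc k) = cong suc (punchIn-inject₁-self k)

punchIn-suc≡punchIn-inject₁ : ∀ {n} (k y : Fin (suc n)) → y ≢ k →
                              punchIn (suc k) y ≡ punchIn (inject₁ k) y
punchIn-suc≡punchIn-inject₁ zero zero y≢k = ⊥-elim (y≢k refl)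
punchIn-suc≡punchIn-inject₁ zero (suc y) _ = refl
punchIn-suc≡punchIn-inject₁ {suc n} (suc k) zero _ = refl
punchIn-suc≡punchIn-inject₁ {suc n} (suc k) (suc y) y≢k =
  cong suc (punchIn-suc≡punchIn-inject₁ k y (y≢k ∘ cong suc))

punchIn-removeAt : ∀ {n} (ρ : Fin (suc n) → Fin (suc n)) j x → ρ (punchIn j x) ≢ j →
                   punchIn j (removeAt ρ j x) ≡ ρ (punchIn j x)
punchIn-removeAt ρ j x ρx≢j with j ≟ ρ (punchIn j x)
... | yes j≡ρx = ⊥-elim (ρx≢j (sym j≡ρx))
... | no j≢ρx = punchIn-punchOut j≢ρx

punchIn-removeAt-bypass : ∀ {n} (ρ : Fin (suc n) → Fin (suc n)) j x →
                          ρ (punchIn j x) ≡ j → ρ j ≢ j →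
                          punchIn j (removeAt ρ j x) ≡ ρ j
punchIn-removeAt-bypass ρ j x ρx≡j ρj≢j with j ≟ ρ (punchIn j x)
... | no j≢ρx = ⊥-elim (j≢ρx (sym ρx≡j))
... | yes _ with j ≟ ρ j
...   | yes j≡ρj = ⊥-elim (ρj≢j (sym j≡ρj))
...   | no j≢ρj = punchIn-punchOut j≢ρj

insertAt-bypass : ∀ {n} {A : Set} (ρ : Fin (suc n) → Fin (suc n)) j (i : Fin n → A) t →
                  punchIn j t ≡ ρ j →
                  ∀ y → insertAt i j (i t) (ρ (punchIn j y)) ≡ i (removeAt ρ j y)
insertAt-bypass ρ j i t t↦ρj y with ρ (punchIn j y) ≟ j
... | no ρy≢j = trans (cong (insertAt i j (i t)) (sym (punchIn-removeAt ρ j y ρy≢j)))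
                      (insertAt-punchIn i j (i t) (removeAt ρ j y))
... | yes ρy≡j = trans (cong (insertAt i j (i t)) ρy≡j)
                       (trans (insertAt-lookup i j (i t)) (cong i (sym removeAt≡t)))
  where
  removeAt≡t : removeAt ρ j y ≡ t
  removeAt≡t = punchIn-injective j _ _
    (trans (punchIn-removeAt-bypass ρ j y ρy≡j (punchInᵢ≢i j t ∘ trans t↦ρj)) (sym t↦ρj))

concatF-↑ˡ : ∀ {m l} (σ : Fin m → Fin m) (τ : Fin l → Fin l) x →
             concatF σ τ (x ↑ˡ l) ≡ σ x ↑ˡ l
concatF-↑ˡ {m} {l} σ τ x rewrite splitAt-↑ˡ m x l = refl

concatF-↑ʳ : ∀ {m l} (σ : Fin m → Fin m) (τ : Fin l → Fin l) y →
             concatF σ τ (m ↑ʳ y) ≡ m ↑ʳ τ y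
concatF-↑ʳ {m} {l} σ τ y rewrite splitAt-↑ʳ m l y = refl

consF-cong : ∀ {n} {A : Set} (a : A) {i j : Fin n → A} → i ≗ j → consF a i ≗ consF a j
consF-cong a i≗j zero    = refl
consF-cong a i≗j (suc x) = i≗j x

consF-++ : ∀ {m l} {A : Set} (a : A) (i : Fin m → A) (j : Fin l → A) →
           consF a (i ++ j) ≗ consF a i ++ j
consF-++ a i j zero = refl
consF-++ {m} a i j (suc x) with splitAt m x
... | Sum.inj₁ _ = refl
... | Sum.inj₂ _ = refl

consF≗insertAt-zero : ∀ {n} {A : Set} (a : A) (i : Fin n → A) →
                      consF a i ≗ insertAt i zero a
consF≗insertAt-zero a i zero    = refl
consF≗insertAt-zero a i (suc x) = refl

consF-insertAt : ∀ {n} {A : Set} (b a : A) (i : Fin n → A) (j : Fin (suc n)) →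
                 consF b (insertAt i j a) ≗ insertAt (consF b i) (suc j) a
consF-insertAt b a i j zero    = refl
consF-insertAt b a i j (suc x) = refl

-- Sums and ordered products in a ring

-- The helper `go` in the definition of sumN is not in scope.  The left-hand side of
-- sumN-go≡sumAlong is therefore left to be inferred; the `with` in sumN≡sumAlong puts its one
-- use into pattern form, so that Agda solves it as `go`.
module _ {c ℓ : Level} (R : Ring c ℓ) where
  open Ring R using (Carrier; _+_; 0#; +-rawMonoid)
  open import Algebra.Definitions.RawMonoid +-rawMonoid using (sum)

  sumAlong : ∀ {p} n → (Fin n → Fin p) → (Fin p → Carrier) → Carrier
  sumAlong zero    e f = 0#
  sumAlong (suc n) e f = f (e zero) + sumAlong n (e ∘ suc) f

  sumAlong≡sum : ∀ {p} n (e : Fin n → Fin p) f → sumAlong n e f ≡ sum (f ∘ e)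
  sumAlong≡sum zero    e f = refl
  sumAlong≡sum (suc n) e f = cong (f (e zero) +_) (sumAlong≡sum n (e ∘ suc) f)

  mutual
    sumN-go≡sumAlong : ∀ p n (e : Fin n → Fin p) (f : Fin p → Carrier) → _ ≡ sumAlong n e f
    sumN-go≡sumAlong p zero    e f = refl
    sumN-go≡sumAlong p (suc n) e f = cong (f (e zero) +_) (sumN-go≡sumAlong p n (e ∘ suc) f)

    sumN≡sumAlong : ∀ N (f : Fin N → Carrier) → GL.sumN R N f ≡ sumAlong N (λ x → x) f
    sumN≡sumAlong zero    f = refl
    sumN≡sumAlong (suc M) f with suc M | Fin.zero {M} | (λ (x : Fin M) → Fin.suc {M} x) | f
    ... | p | z | s | g = cong (g z +_) (sumN-go≡sumAlong p M s g)

  sumN≡sum : ∀ N (f : Fin N → Carrier) → GL.sumN R N f ≡ sum f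
  sumN≡sum N f = trans (sumN≡sumAlong N f) (sumAlong≡sum N (λ x → x) f)

module Sums {c ℓ : Level} (R : Ring c ℓ) (N : ℕ) where
  open Ring R hiding (refl; sym; trans; zero; reflexive)
  open Ring R using (reflexive) renaming (refl to ≈-refl; sym to ≈-sym; trans to ≈-trans)
  open GL R N
  open import Algebra.Properties.Semiring.Sum semiring
    using ( sum; sum-syntax; sum-cong-≋; ∑-distrib-+; ∑-comm; *-distribˡ-sum; *-distribʳ-sum
          ; sum-remove; sum-replicate-zero)
  open import Algebra.Properties.Ring R using (-1*x≈-x; x[y-z]≈xy-xz; [y-z]x≈yx-zx)
  open import Relation.Binary.Reasoning.Setoid setoid

  sum-neg : ∀ {n} (f : Fin n → Carrier) → sum (λ a → - f a) ≈ - sum f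
  sum-neg f = begin
    sum (λ a → - f a)      ≈⟨ sum-cong-≋ (λ a → -1*x≈-x (f a)) ⟨
    sum (λ a → - 1# * f a) ≈⟨ *-distribˡ-sum (- 1#) f ⟨
    - 1# * sum f           ≈⟨ -1*x≈-x (sum f) ⟩
    - sum f                ∎

  sum-distrib-- : ∀ {n} (f g : Fin n → Carrier) → sum (λ a → f a - g a) ≈ sum f - sum g
  sum-distrib-- f g = ≈-trans (∑-distrib-+ f (λ a → - g a)) (+-congˡ (sum-neg g))

  sum-const : ∀ n x → sum {n} (λ _ → x) ≈ natMul n x
  sum-const zero    x = ≈-refl
  sum-const (suc n) x = +-congˡ (sum-const n x)

  sum-single : ∀ {n} (b : Fin n) (f : Fin n → Carrier) →
               (∀ x → x ≢ b → f x ≈ 0#) → sum f ≈ f b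
  sum-single {suc n} b f vanish = begin
    sum f                             ≈⟨ sum-remove {i = b} f ⟩
    f b + sum (λ x → f (punchIn b x)) ≈⟨ +-congˡ (sum-cong-≋ (λ x → vanish _ (punchInᵢ≢i b x))) ⟩
    f b + sum {n} (λ _ → 0#)          ≈⟨ +-congˡ (sum-replicate-zero n) ⟩
    f b + 0#                          ≈⟨ +-identityʳ (f b) ⟩
    f b                               ∎

  δ-refl : ∀ a → δ a a ≈ 1#
  δ-refl a with a ≟ a
  ... | yes _ = ≈-refl
  ... | no a≢a = ⊥-elim (a≢a refl)

  δ-≢ : ∀ {a b} → a ≢ b → δ a b ≈ 0#
  δ-≢ {a} {b} a≢b with a ≟ b
  ... | yes a≡b = ⊥-elim (a≢b a≡b)
  ... | no _ = ≈-refl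

  δ-central : ∀ a b x → δ a b * x ≈ x * δ a b
  δ-central a b x with a ≟ b
  ... | yes _ = ≈-trans (*-identityˡ x) (≈-sym (*-identityʳ x))
  ... | no _ = ≈-trans (zeroˡ x) (≈-sym (zeroʳ x))

  sum-δˡ : ∀ b (f : Fin N → Carrier) → sum (λ a → δ a b * f a) ≈ f b
  sum-δˡ b f = ≈-trans
    (sum-single b _ (λ a a≢b → ≈-trans (*-congʳ (δ-≢ a≢b)) (zeroˡ (f a))))
    (≈-trans (*-congʳ (δ-refl b)) (*-identityˡ (f b)))

  sum-δʳ : ∀ b (f : Fin N → Carrier) → sum (λ a → δ b a * f a) ≈ f b
  sum-δʳ b f = ≈-trans
    (sum-single b _ (λ a a≢b → ≈-trans (*-congʳ (δ-≢ (a≢b ∘ sym))) (zeroˡ (f a))))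
    (≈-trans (*-congʳ (δ-refl b)) (*-identityˡ (f b)))

  prodOrd-cong : ∀ n {f g : Fin n → Carrier} → (∀ x → f x ≈ g x) →
                 prodOrd n f ≈ prodOrd n g
  prodOrd-cong zero    f≈g = ≈-refl
  prodOrd-cong (suc n) f≈g = *-cong (f≈g zero) (prodOrd-cong n (f≈g ∘ suc))

  prodOrd-++ : ∀ m l (f : Fin (m ℕ.+ l) → Carrier) →
               prodOrd (m ℕ.+ l) f ≈
               prodOrd m (λ x → f (x ↑ˡ l)) * prodOrd l (λ y → f (m ↑ʳ y))
  prodOrd-++ zero    l f = ≈-sym (*-identityˡ _)
  prodOrd-++ (suc m) l f = ≈-trans (*-congˡ (prodOrd-++ m l (f ∘ suc))) (≈-sym (*-assoc _ _ _))

  prodOrd-merge : ∀ n (k : Fin (suc n)) (f : Fin (suc (suc n)) → Carrier) →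
                  prodOrd (suc (suc n)) f ≈
                  prodOrd (suc n) (insertAt (λ z → f (punchIn (suc k) (punchIn k z))) k
                                            (f (inject₁ k) * f (suc k)))
  prodOrd-merge n       zero    f = ≈-sym (*-assoc _ _ _)
  prodOrd-merge (suc n) (suc k) f = *-congˡ (prodOrd-merge n k (f ∘ suc))

  prodOrd≈insertAt : ∀ n (k : Fin (suc n)) (f : Fin (suc n) → Carrier) {ψ : Fin n → Carrier} {x} →
                     (∀ z → f (punchIn k z) ≈ ψ z) → f k ≈ x →
                     prodOrd (suc n) f ≈ prodOrd (suc n) (insertAt ψ k x)
  prodOrd≈insertAt n       zero    f ψ≈ fk≈x = *-cong fk≈x (prodOrd-cong n ψ≈)
  prodOrd≈insertAt (suc n) (suc k) f ψ≈ fk≈x =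
    *-cong (ψ≈ zero) (prodOrd≈insertAt n k (f ∘ suc) (ψ≈ ∘ suc) fk≈x)

  prodOrd-insertAt-cong : ∀ n (k : Fin (suc n)) {ψ ψ′ : Fin n → Carrier} {x x′} →
                          (∀ z → ψ z ≈ ψ′ z) → x ≈ x′ →
                          prodOrd (suc n) (insertAt ψ k x) ≈ prodOrd (suc n) (insertAt ψ′ k x′)
  prodOrd-insertAt-cong n k {ψ} {x = x} ψ≈ x≈ = prodOrd≈insertAt n k (insertAt ψ k x)
    (λ z → ≈-trans (reflexive (insertAt-punchIn ψ k x z)) (ψ≈ z))
    (≈-trans (reflexive (insertAt-lookup ψ k x)) x≈)

  prodOrd-insertAt-commuting : ∀ n (ψ : Fin n → Carrier) k x → (∀ z → x * ψ z ≈ ψ z * x) →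
                               prodOrd (suc n) (insertAt ψ k x) ≈ x * prodOrd n ψ
  prodOrd-insertAt-commuting n       ψ zero    x comm = ≈-refl
  prodOrd-insertAt-commuting (suc n) ψ (suc k) x comm = begin
    ψ zero * prodOrd (suc n) (insertAt (ψ ∘ suc) k x)
      ≈⟨ *-congˡ (prodOrd-insertAt-commuting n (ψ ∘ suc) k x (comm ∘ suc)) ⟩
    ψ zero * (x * prodOrd n (ψ ∘ suc)) ≈⟨ *-assoc _ _ _ ⟨
    ψ zero * x * prodOrd n (ψ ∘ suc)   ≈⟨ *-congʳ (comm zero) ⟨
    x * ψ zero * prodOrd n (ψ ∘ suc)   ≈⟨ *-assoc _ _ _ ⟩
    x * (ψ zero * prodOrd n (ψ ∘ suc)) ∎

  Sandwich : (Carrier → Carrier) → Set (c Level.⊔ ℓ)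
  Sandwich φ = ∃₂ λ l r → ∀ x → φ x ≈ l * (x * r)

  prodOrd-insertAt-sandwich : ∀ n (ψ : Fin n → Carrier) k →
                              Sandwich (λ x → prodOrd (suc n) (insertAt ψ k x))
  prodOrd-insertAt-sandwich n ψ zero = 1# , prodOrd n ψ , λ x → ≈-sym (*-identityˡ _)
  prodOrd-insertAt-sandwich (suc n) ψ (suc k) with prodOrd-insertAt-sandwich n (ψ ∘ suc) k
  ... | l , r , φ≈ = ψ zero * l , r , λ x → ≈-trans (*-congˡ (φ≈ x)) (≈-sym (*-assoc _ _ _))

  sandwich-distrib-- : ∀ {φ} → Sandwich φ → ∀ x y → φ (x - y) ≈ φ x - φ y
  sandwich-distrib-- {φ} (l , r , φ≈) x y = begin
    φ (x - y)                 ≈⟨ φ≈ (x - y) ⟩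
    l * ((x - y) * r)         ≈⟨ *-congˡ ([y-z]x≈yx-zx r x y) ⟩
    l * (x * r - y * r)       ≈⟨ x[y-z]≈xy-xz l (x * r) (y * r) ⟩
    l * (x * r) - l * (y * r) ≈⟨ +-cong (φ≈ x) (-‿cong (φ≈ y)) ⟨
    φ x - φ y                 ∎

  sandwich-sum : ∀ {φ} → Sandwich φ → ∀ {n} (f : Fin n → Carrier) →
                 φ (sum f) ≈ sum (λ a → φ (f a))
  sandwich-sum {φ} (l , r , φ≈) {n} f = begin
    φ (sum f)                 ≈⟨ φ≈ (sum f) ⟩
    l * (sum f * r)           ≈⟨ *-congˡ (*-distribʳ-sum r f) ⟩
    l * sum (λ a → f a * r)   ≈⟨ *-distribˡ-sum {n} l _ ⟩
    sum (λ a → l * (f a * r)) ≈⟨ sum-cong-≋ (λ a → φ≈ (f a)) ⟨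
    sum (λ a → φ (f a))       ∎

  sandwich-central : ∀ {φ} → Sandwich φ → ∀ a x → (∀ y → a * y ≈ y * a) →
                     φ (a * x) ≈ a * φ x
  sandwich-central {φ} (l , r , φ≈) a x central = begin
    φ (a * x)         ≈⟨ φ≈ (a * x) ⟩
    l * (a * x * r)   ≈⟨ *-congˡ (*-assoc a x r) ⟩
    l * (a * (x * r)) ≈⟨ *-assoc l a (x * r) ⟨
    l * a * (x * r)   ≈⟨ *-congʳ (central l) ⟨
    a * l * (x * r)   ≈⟨ *-assoc a l (x * r) ⟩
    a * (l * (x * r)) ≈⟨ *-congˡ (φ≈ x) ⟨
    a * φ x           ∎

  -- Without function extensionality, changing the variables of a sum over assignments requires
  -- the summand to respect pointwise equality of assignments.
  Extensional : ∀ {n} → ((Fin n → Fin N) → Carrier) → Set ℓ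
  Extensional F = F Preserves _≗_ ⟶ _≈_

  sumAssign-suc : ∀ n (F : (Fin (suc n) → Fin N) → Carrier) →
                  sumAssign (suc n) F ≡ ∑[ a < N ] sumAssign n (λ i → F (consF a i))
  sumAssign-suc n F = sumN≡sum R N _

  sumAssign-cong : ∀ n {F G : (Fin n → Fin N) → Carrier} → (∀ i → F i ≈ G i) →
                   sumAssign n F ≈ sumAssign n G
  sumAssign-cong zero    F≈G = F≈G _
  sumAssign-cong (suc n) {F} {G} F≈G = begin
    sumAssign (suc n) F
      ≡⟨ sumAssign-suc n F ⟩
    ∑[ a < N ] sumAssign n (λ i → F (consF a i))
      ≈⟨ sum-cong-≋ (λ a → sumAssign-cong n (λ i → F≈G (consF a i))) ⟩
    ∑[ a < N ] sumAssign n (λ i → G (consF a i))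
      ≡⟨ sumAssign-suc n G ⟨
    sumAssign (suc n) G
      ∎

  sumAssign-distrib-- : ∀ n (F G : (Fin n → Fin N) → Carrier) →
                        sumAssign n (λ i → F i - G i) ≈ sumAssign n F - sumAssign n G
  sumAssign-distrib-- zero    F G = ≈-refl
  sumAssign-distrib-- (suc n) F G = begin
    sumAssign (suc n) (λ i → F i - G i)
      ≡⟨ sumAssign-suc n (λ i → F i - G i) ⟩
    ∑[ a < N ] sumAssign n (λ i → F (consF a i) - G (consF a i))
      ≈⟨ sum-cong-≋ (λ a → sumAssign-distrib-- n (F ∘ consF a) (G ∘ consF a)) ⟩
    ∑[ a < N ] (sumAssign n (F ∘ consF a) - sumAssign n (G ∘ consF a))
      ≈⟨ sum-distrib-- (λ a → sumAssign n (F ∘ consF a)) (λ a → sumAssign n (G ∘ consF a)) ⟩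
    ∑[ a < N ] sumAssign n (F ∘ consF a) - ∑[ a < N ] sumAssign n (G ∘ consF a)
      ≡⟨ cong₂ _-_ (sumAssign-suc n F) (sumAssign-suc n G) ⟨
    sumAssign (suc n) F - sumAssign (suc n) G
      ∎

  sumAssign-*ˡ : ∀ n x (F : (Fin n → Fin N) → Carrier) →
                 sumAssign n (λ i → x * F i) ≈ x * sumAssign n F
  sumAssign-*ˡ zero    x F = ≈-refl
  sumAssign-*ˡ (suc n) x F = begin
    sumAssign (suc n) (λ i → x * F i)
      ≡⟨ sumAssign-suc n (λ i → x * F i) ⟩
    ∑[ a < N ] sumAssign n (λ i → x * F (consF a i))
      ≈⟨ sum-cong-≋ (λ a → sumAssign-*ˡ n x (F ∘ consF a)) ⟩
    ∑[ a < N ] (x * sumAssign n (F ∘ consF a))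
      ≈⟨ *-distribˡ-sum x (λ a → sumAssign n (F ∘ consF a)) ⟨
    x * ∑[ a < N ] sumAssign n (F ∘ consF a)
      ≡⟨ cong (x *_) (sumAssign-suc n F) ⟨
    x * sumAssign (suc n) F
      ∎

  sumAssign-*ʳ : ∀ n x (F : (Fin n → Fin N) → Carrier) →
                 sumAssign n (λ i → F i * x) ≈ sumAssign n F * x
  sumAssign-*ʳ zero    x F = ≈-refl
  sumAssign-*ʳ (suc n) x F = begin
    sumAssign (suc n) (λ i → F i * x)
      ≡⟨ sumAssign-suc n (λ i → F i * x) ⟩
    ∑[ a < N ] sumAssign n (λ i → F (consF a i) * x)
      ≈⟨ sum-cong-≋ (λ a → sumAssign-*ʳ n x (F ∘ consF a)) ⟩
    ∑[ a < N ] (sumAssign n (F ∘ consF a) * x)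
      ≈⟨ *-distribʳ-sum x (λ a → sumAssign n (F ∘ consF a)) ⟨
    ∑[ a < N ] sumAssign n (F ∘ consF a) * x
      ≡⟨ cong (_* x) (sumAssign-suc n F) ⟨
    sumAssign (suc n) F * x
      ∎

  sum-sumAssign-comm : ∀ n (G : Fin N → (Fin n → Fin N) → Carrier) →
                       ∑[ a < N ] sumAssign n (G a) ≈ sumAssign n (λ i → ∑[ a < N ] G a i)
  sum-sumAssign-comm zero    G = ≈-refl
  sum-sumAssign-comm (suc n) G = begin
    ∑[ a < N ] sumAssign (suc n) (G a)
      ≈⟨ sum-cong-≋ (λ a → reflexive (sumAssign-suc n (G a))) ⟩
    ∑[ a < N ] ∑[ b < N ] sumAssign n (λ i → G a (consF b i))
      ≈⟨ ∑-comm (λ a b → sumAssign n (λ i → G a (consF b i))) ⟩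
    ∑[ b < N ] ∑[ a < N ] sumAssign n (λ i → G a (consF b i))
      ≈⟨ sum-cong-≋ (λ b → sum-sumAssign-comm n (λ a i → G a (consF b i))) ⟩
    ∑[ b < N ] sumAssign n (λ i → ∑[ a < N ] G a (consF b i))
      ≡⟨ sumAssign-suc n (λ i → ∑[ a < N ] G a i) ⟨
    sumAssign (suc n) (λ i → ∑[ a < N ] G a i)
      ∎

  sumAssign-insertAt : ∀ n (j : Fin (suc n)) (F : (Fin (suc n) → Fin N) → Carrier) →
                       Extensional F →
                       sumAssign (suc n) F ≈ ∑[ a < N ] sumAssign n (λ i → F (insertAt i j a))
  sumAssign-insertAt n zero F F-ext = begin
    sumAssign (suc n) F
      ≡⟨ sumAssign-suc n F ⟩
    ∑[ a < N ] sumAssign n (λ i → F (consF a i))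
      ≈⟨ sum-cong-≋ (λ a → sumAssign-cong n (λ i → F-ext (consF≗insertAt-zero a i))) ⟩
    ∑[ a < N ] sumAssign n (λ i → F (insertAt i zero a))
      ∎
  sumAssign-insertAt (suc n) (suc j) F F-ext = begin
    sumAssign (suc (suc n)) F
      ≡⟨ sumAssign-suc (suc n) F ⟩
    ∑[ b < N ] sumAssign (suc n) (λ i → F (consF b i))
      ≈⟨ sum-cong-≋ (λ b → sumAssign-insertAt n j (F ∘ consF b) (F-ext ∘ consF-cong b)) ⟩
    ∑[ b < N ] ∑[ a < N ] sumAssign n (λ i → F (consF b (insertAt i j a)))
      ≈⟨ ∑-comm (λ b a → sumAssign n (λ i → F (consF b (insertAt i j a)))) ⟩
    ∑[ a < N ] ∑[ b < N ] sumAssign n (λ i → F (consF b (insertAt i j a)))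
      ≈⟨ sum-cong-≋ (λ a → sum-cong-≋ (λ b → sumAssign-cong n (λ i →
           F-ext (consF-insertAt b a i j)))) ⟩
    ∑[ a < N ] ∑[ b < N ] sumAssign n (λ i → F (insertAt (consF b i) (suc j) a))
      ≈⟨ sum-cong-≋ (λ a → reflexive (sumAssign-suc n (λ i → F (insertAt i (suc j) a)))) ⟨
    ∑[ a < N ] sumAssign (suc n) (λ i → F (insertAt i (suc j) a))
      ∎

  sumAssign-permute : ∀ n (π : Permutation′ n) (F : (Fin n → Fin N) → Carrier) →
                      Extensional F →
                      sumAssign n F ≈ sumAssign n (λ i → F (i ∘ (π ⟨$⟩ʳ_)))
  sumAssign-permute zero    π F F-ext = F-ext (λ ())
  sumAssign-permute (suc n) π F F-ext = begin
    sumAssign (suc n) F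
      ≡⟨ sumAssign-suc n F ⟩
    ∑[ a < N ] sumAssign n (λ i → F (consF a i))
      ≈⟨ sum-cong-≋ (λ a → sumAssign-permute n π₀ (F ∘ consF a) (F-ext ∘ consF-cong a)) ⟩
    ∑[ a < N ] sumAssign n (λ i → F (consF a (i ∘ (π₀ ⟨$⟩ʳ_))))
      ≈⟨ sum-cong-≋ (λ a → sumAssign-cong n (λ i → F-ext (consF-permute a i))) ⟩
    ∑[ a < N ] sumAssign n (λ i → F (insertAt i p a ∘ (π ⟨$⟩ʳ_)))
      ≈⟨ sumAssign-insertAt n p (λ i → F (i ∘ (π ⟨$⟩ʳ_)))
                                (λ i≗j → F-ext (i≗j ∘ (π ⟨$⟩ʳ_))) ⟨
    sumAssign (suc n) (λ i → F (i ∘ (π ⟨$⟩ʳ_)))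
      ∎
    where
    p : Fin (suc n)
    p = π ⟨$⟩ʳ zero
    π₀ : Permutation′ n
    π₀ = Perm.remove zero π
    consF-permute : ∀ a i → consF a (i ∘ (π₀ ⟨$⟩ʳ_)) ≗ insertAt i p a ∘ (π ⟨$⟩ʳ_)
    consF-permute a i zero    = sym (insertAt-lookup i p a)
    consF-permute a i (suc x) = sym (trans (cong (insertAt i p a) (Perm.punchIn-permute π zero x))
                                           (insertAt-punchIn i p a (π₀ ⟨$⟩ʳ x)))

  sumAssign-++ : ∀ m l (F : (Fin (m ℕ.+ l) → Fin N) → Carrier) → Extensional F →
                 sumAssign (m ℕ.+ l) F ≈ sumAssign m (λ i → sumAssign l (λ j → F (i ++ j)))
  sumAssign-++ zero    l F F-ext = ≈-refl
  sumAssign-++ (suc m) l F F-ext = begin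
    sumAssign (suc m ℕ.+ l) F
      ≡⟨ sumAssign-suc (m ℕ.+ l) F ⟩
    ∑[ a < N ] sumAssign (m ℕ.+ l) (λ i → F (consF a i))
      ≈⟨ sum-cong-≋ (λ a → sumAssign-++ m l (F ∘ consF a) (F-ext ∘ consF-cong a)) ⟩
    ∑[ a < N ] sumAssign m (λ i → sumAssign l (λ j → F (consF a (i ++ j))))
      ≈⟨ sum-cong-≋ (λ a → sumAssign-cong m (λ i → sumAssign-cong l (λ j →
           F-ext (consF-++ a i j)))) ⟩
    ∑[ a < N ] sumAssign m (λ i → sumAssign l (λ j → F (consF a i ++ j)))
      ≡⟨ sumAssign-suc m (λ i → sumAssign l (λ j → F (i ++ j))) ⟨
    sumAssign (suc m) (λ i → sumAssign l (λ j → F (i ++ j)))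
      ∎

-- Monomials of gl_N

module Words {c ℓ : Level} (R : Ring c ℓ) (N : ℕ)
             (E : Fin N → Fin N → Ring.Carrier R) (gl : GL.IsGLFamily R N E) where
  open Ring R hiding (refl; sym; trans; zero; reflexive)
  open Ring R using (reflexive) renaming (refl to ≈-refl; sym to ≈-sym; trans to ≈-trans)
  open GL R N
  open Sums R N
  open import Algebra.Properties.Semiring.Sum semiring
    using (sum; sum-syntax; sum-cong-≋; *-distribˡ-sum; *-distribʳ-sum)
  open import Algebra.Properties.Group +-group using (x∙y⁻¹≈ε⇒x≈y)
  open import Relation.Binary.Reasoning.Setoid setoid

  edge : ∀ {n} → (Fin n → Fin n) → (Fin n → Fin N) → Fin n → Carrier
  edge ρ i x = E (i x) (i (ρ x))

  monomial : ∀ {n} → (Fin n → Fin n) → (Fin n → Fin N) → Carrier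
  monomial {n} ρ i = prodOrd n (edge ρ i)

  edge-cong : ∀ {n} (ρ : Fin n → Fin n) {i j : Fin n → Fin N} → i ≗ j →
              ∀ x → edge ρ i x ≈ edge ρ j x
  edge-cong ρ i≗j x = reflexive (cong₂ E (i≗j x) (i≗j (ρ x)))

  monomial-ext : ∀ {n} (ρ : Fin n → Fin n) → Extensional (monomial ρ)
  monomial-ext {n} ρ i≗j = prodOrd-cong n (edge-cong ρ i≗j)

  w-empty : Part1 E
  w-empty σ = ≈-refl

  w-cycle : Part3 E
  w-cycle k _ = ≈-refl

  monomial-concat : ∀ {m l} (σ : Fin m → Fin m) (τ : Fin l → Fin l) i j →
                    monomial (concatF σ τ) (i ++ j) ≈ monomial σ i * monomial τ j
  monomial-concat {m} {l} σ τ i j = ≈-trans (prodOrd-++ m l _) (*-cong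
    (prodOrd-cong m (λ x → reflexive (cong₂ E (lookup-++ˡ i j x)
      (trans (cong (i ++ j) (concatF-↑ˡ σ τ x)) (lookup-++ˡ i j (σ x))))))
    (prodOrd-cong l (λ y → reflexive (cong₂ E (lookup-++ʳ i j y)
      (trans (cong (i ++ j) (concatF-↑ʳ σ τ y)) (lookup-++ʳ i j (τ y)))))))

  w-concat : Part2 E
  w-concat m l σ τ = begin
    sumAssign (m ℕ.+ l) (monomial (concatF σ′ τ′))
      ≈⟨ sumAssign-++ m l _ (monomial-ext (concatF σ′ τ′)) ⟩
    sumAssign m (λ i → sumAssign l (λ j → monomial (concatF σ′ τ′) (i ++ j)))
      ≈⟨ sumAssign-cong m (λ i → sumAssign-cong l (monomial-concat σ′ τ′ i)) ⟩
    sumAssign m (λ i → sumAssign l (λ j → monomial σ′ i * monomial τ′ j))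
      ≈⟨ sumAssign-cong m (λ i → sumAssign-*ˡ l (monomial σ′ i) (monomial τ′)) ⟩
    sumAssign m (λ i → monomial σ′ i * sumAssign l (monomial τ′))
      ≈⟨ sumAssign-*ʳ m (sumAssign l (monomial τ′)) (monomial σ′) ⟩
    sumAssign m (monomial σ′) * sumAssign l (monomial τ′)
      ∎
    where
    σ′ = σ ⟨$⟩ʳ_
    τ′ = τ ⟨$⟩ʳ_

  w-conjugate : ∀ {n} (s : Fin n → Fin n) → (∀ x → s (s x) ≡ x) → (σ : Fin n → Fin n) →
                w E (λ x → s (σ (s x))) ≈ sumAssign n (λ i → prodOrd n (λ x → edge σ i (s x)))
  w-conjugate {n} s s-involutive σ = begin
    sumAssign n (monomial (λ x → s (σ (s x))))
      ≈⟨ sumAssign-permute n (Perm.permutation s s s-involutive s-involutive) _ (monomial-ext _) ⟩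
    sumAssign n (λ i → monomial (λ x → s (σ (s x))) (i ∘ s))
      ≈⟨ sumAssign-cong n (λ i → prodOrd-cong n (λ x →
           reflexive (cong (E (i (s x))) (cong i (s-involutive (σ (s x))))))) ⟩
    sumAssign n (λ i → prodOrd n (λ x → edge σ i (s x)))
      ∎

  w-removeAt : ∀ n (ρ : Fin (suc n) → Fin (suc n)) j → ρ j ≢ j →
               sumAssign (suc n) (λ i → δ (i (ρ j)) (i j) * prodOrd n (λ y → edge ρ i (punchIn j y)))
               ≈ w E (removeAt ρ j)
  w-removeAt n ρ j ρj≢j = begin
    sumAssign (suc n) F
      ≈⟨ sumAssign-insertAt n j F F-ext ⟩
    ∑[ a < N ] sumAssign n (λ i → F (insertAt i j a))
      ≈⟨ sum-cong-≋ (λ a → sumAssign-cong n (λ i →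
           *-congʳ (reflexive (cong₂ δ (insertAt-ρj i a) (insertAt-lookup i j a))))) ⟩
    ∑[ a < N ] sumAssign n (λ i → δ (i t) a * P i a)
      ≈⟨ sum-sumAssign-comm n (λ a i → δ (i t) a * P i a) ⟩
    sumAssign n (λ i → ∑[ a < N ] (δ (i t) a * P i a))
      ≈⟨ sumAssign-cong n (λ i → sum-δʳ (i t) (P i)) ⟩
    sumAssign n (λ i → P i (i t))
      ≈⟨ sumAssign-cong n (λ i → prodOrd-cong n (λ y → reflexive
           (cong₂ E (insertAt-punchIn i j (i t) y) (insertAt-bypass ρ j i t t↦ρj y)))) ⟩
    sumAssign n (monomial (removeAt ρ j))
      ∎
    where
    t : Fin n
    t = punchOut (ρj≢j ∘ sym)
    t↦ρj : punchIn j t ≡ ρ j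
    t↦ρj = punchIn-punchOut (ρj≢j ∘ sym)
    F : (Fin (suc n) → Fin N) → Carrier
    F i = δ (i (ρ j)) (i j) * prodOrd n (λ y → edge ρ i (punchIn j y))
    F-ext : Extensional F
    F-ext i≗j = *-cong (reflexive (cong₂ δ (i≗j _) (i≗j _)))
                       (prodOrd-cong n (λ y → edge-cong ρ i≗j (punchIn j y)))
    P : (Fin n → Fin N) → Fin N → Carrier
    P i a = prodOrd n (λ y → edge ρ (insertAt i j a) (punchIn j y))
    insertAt-ρj : ∀ i a → insertAt i j a (ρ j) ≡ i t
    insertAt-ρj i a = trans (cong (insertAt i j a) (sym t↦ρj)) (insertAt-punchIn i j a t)

  trace : Carrier
  trace = ∑[ a < N ] E a a

  C₁≈trace : C E 1 ≈ trace
  C₁≈trace = ≈-trans (reflexive (sumN≡sum R N _)) (sum-cong-≋ (λ a → *-identityʳ (E a a)))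

  trace-commutes : ∀ p q → trace * E p q ≈ E p q * trace
  trace-commutes p q = x∙y⁻¹≈ε⇒x≈y _ _ (begin
    trace * E p q - E p q * trace
      ≈⟨ +-cong (*-distribʳ-sum (E p q) (λ a → E a a))
                (-‿cong (*-distribˡ-sum (E p q) (λ a → E a a))) ⟩
    ∑[ a < N ] (E a a * E p q) - ∑[ a < N ] (E p q * E a a)
      ≈⟨ sum-distrib-- (λ a → E a a * E p q) (λ a → E p q * E a a) ⟨
    ∑[ a < N ] (E a a * E p q - E p q * E a a)
      ≈⟨ sum-cong-≋ (λ a → gl a a p q) ⟩
    ∑[ a < N ] (δ a p * E a q - δ q a * E p a)
      ≈⟨ sum-distrib-- (λ a → δ a p * E a q) (λ a → δ q a * E p a) ⟩
    ∑[ a < N ] (δ a p * E a q) - ∑[ a < N ] (δ q a * E p a)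
      ≈⟨ +-cong (sum-δˡ p (λ a → E a q)) (-‿cong (sum-δʳ q (E p))) ⟩
    E p q - E p q
      ≈⟨ -‿inverseʳ (E p q) ⟩
    0# ∎)

  module Adjacent {n} (σ : Fin (suc (suc n)) → Fin (suc (suc n))) (k : Fin (suc n)) where

    m : ℕ
    m = suc (suc n)

    kA kB : Fin m
    kA = inject₁ k
    kB = suc k

    s τ : Fin m → Fin m
    s = swapF kA kB
    τ x = σ (s x)

    τ-kA : τ kA ≡ σ kB
    τ-kA = cong σ (transpose-applyˡ kA kB)

    τ-kB : τ kB ≡ σ kA
    τ-kB = cong σ (transpose-applyʳ kA kB)

    out : Fin n → Fin m
    out z = punchIn kB (punchIn k z)

    out≡punchIn-kA : ∀ z → out z ≡ punchIn kA (punchIn k z)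
    out≡punchIn-kA z = punchIn-suc≡punchIn-inject₁ k (punchIn k z) (punchInᵢ≢i k z)

    s-out : ∀ z → s (out z) ≡ out z
    s-out z = transpose-fix (punchInᵢ≢i kA (punchIn k z) ∘ trans (sym (out≡punchIn-kA z)))
                            (punchInᵢ≢i kB (punchIn k z))

    slot : (Fin m → Fin N) → Carrier → Carrier
    slot i x = prodOrd (suc n) (insertAt (λ z → edge σ i (out z)) k x)

    slot-sandwich : ∀ i → Sandwich (slot i)
    slot-sandwich i = prodOrd-insertAt-sandwich n (λ z → edge σ i (out z)) k

    slot-cong : ∀ {i j x y} → i ≗ j → x ≈ y → slot i x ≈ slot j y
    slot-cong i≗j x≈y = prodOrd-insertAt-cong n k (λ z → edge-cong σ i≗j (out z)) x≈y

    term : (u v p q : Fin m) → (Fin m → Fin N) → Carrier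
    term u v p q i = δ (i u) (i v) * slot i (E (i p) (i q))

    term-ext : ∀ u v p q → Extensional (term u v p q)
    term-ext u v p q i≗j = *-cong (reflexive (cong₂ δ (i≗j u) (i≗j v)))
                                  (slot-cong i≗j (reflexive (cong₂ E (i≗j p) (i≗j q))))

    term₁ term₂ : (Fin m → Fin N) → Carrier
    term₁ = term (σ kA) kB kA (σ kB)
    term₂ = term (σ kB) kA kB (σ kA)

    monomial-difference : ∀ i → monomial σ i - prodOrd m (λ x → edge σ i (s x)) ≈
                                term₁ i - term₂ i
    monomial-difference i = begin
      prodOrd m g - prodOrd m (g ∘ s)
        ≈⟨ +-cong (prodOrd-merge n k g) (-‿cong (≈-trans (prodOrd-merge n k (g ∘ s))
             (prodOrd-insertAt-cong n k (λ z → reflexive (cong g (s-out z)))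
               (reflexive (cong₂ _*_ (cong g (transpose-applyˡ kA kB))
                                     (cong g (transpose-applyʳ kA kB))))))) ⟩
      slot i (g kA * g kB) - slot i (g kB * g kA)
        ≈⟨ sandwich-distrib-- (slot-sandwich i) (g kA * g kB) (g kB * g kA) ⟨
      slot i (g kA * g kB - g kB * g kA)
        ≈⟨ slot-cong {i} (λ _ → refl) (gl (i kA) (i (σ kA)) (i kB) (i (σ kB))) ⟩
      slot i (δ₁ * E (i kA) (i (σ kB)) - δ₂ * E (i kB) (i (σ kA)))
        ≈⟨ sandwich-distrib-- (slot-sandwich i) _ _ ⟩
      slot i (δ₁ * E (i kA) (i (σ kB))) - slot i (δ₂ * E (i kB) (i (σ kA)))
        ≈⟨ +-cong (sandwich-central (slot-sandwich i) δ₁ _ (δ-central (i (σ kA)) (i kB)))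
                  (-‿cong (sandwich-central (slot-sandwich i) δ₂ _ (δ-central (i (σ kB)) (i kA)))) ⟩
      term₁ i - term₂ i
        ∎
      where
      g = edge σ i
      δ₁ = δ (i (σ kA)) (i kB)
      δ₂ = δ (i (σ kB)) (i kA)

    w-sub-w-conjugate : w E σ - w E (λ x → s (σ (s x))) ≈ sumAssign m term₁ - sumAssign m term₂
    w-sub-w-conjugate = begin
      w E σ - w E (λ x → s (σ (s x)))
        ≈⟨ +-congˡ (-‿cong (w-conjugate s (transpose-involutive kA kB) σ)) ⟩
      sumAssign m (monomial σ) - sumAssign m (λ i → prodOrd m (λ x → edge σ i (s x)))
        ≈⟨ sumAssign-distrib-- m (monomial σ) (λ i → prodOrd m (λ x → edge σ i (s x))) ⟨
      sumAssign m (λ i → monomial σ i - prodOrd m (λ x → edge σ i (s x)))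
        ≈⟨ sumAssign-cong m monomial-difference ⟩
      sumAssign m (λ i → term₁ i - term₂ i)
        ≈⟨ sumAssign-distrib-- m term₁ term₂ ⟩
      sumAssign m term₁ - sumAssign m term₂
        ∎

    prodOrd-removed≈slot : ∀ j i → (∀ z → punchIn j (punchIn k z) ≡ out z) →
                           prodOrd (suc n) (λ y → edge τ i (punchIn j y)) ≈
                           slot i (edge τ i (punchIn j k))
    prodOrd-removed≈slot j i out-eq = prodOrd≈insertAt n k (λ y → edge τ i (punchIn j y))
      (λ z → reflexive (trans (cong (edge τ i) (out-eq z))
                              (cong (λ u → E (i (out z)) (i (σ u))) (s-out z))))
      ≈-refl

    sum-term₁ : σ kA ≢ kB → sumAssign m term₁ ≈ w E (removeAt τ kB)
    sum-term₁ σkA≢kB = ≈-trans (sumAssign-cong m contracted)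
                               (w-removeAt (suc n) τ kB (σkA≢kB ∘ trans (sym τ-kB)))
      where
      contracted : ∀ i → term₁ i ≈
                         δ (i (τ kB)) (i kB) * prodOrd (suc n) (λ y → edge τ i (punchIn kB y))
      contracted i = *-cong (reflexive (cong (λ u → δ (i u) (i kB)) (sym τ-kB)))
        (≈-sym (≈-trans (prodOrd-removed≈slot kB i (λ _ → refl))
          (slot-cong {i} (λ _ → refl) (reflexive (trans (cong (edge τ i) (punchIn-suc-self k))
                                                       (cong (E (i kA) ∘ i) τ-kA))))))

    sum-term₂ : σ kB ≢ kA → sumAssign m term₂ ≈ w E (removeAt τ kA)
    sum-term₂ σkB≢kA = ≈-trans (sumAssign-cong m contracted)
                               (w-removeAt (suc n) τ kA (σkB≢kA ∘ trans (sym τ-kA)))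
      where
      contracted : ∀ i → term₂ i ≈
                         δ (i (τ kA)) (i kA) * prodOrd (suc n) (λ y → edge τ i (punchIn kA y))
      contracted i = *-cong (reflexive (cong (λ u → δ (i u) (i kA)) (sym τ-kA)))
        (≈-sym (≈-trans (prodOrd-removed≈slot kA i (sym ∘ out≡punchIn-kA))
          (slot-cong {i} (λ _ → refl) (reflexive (trans (cong (edge τ i) (punchIn-inject₁-self k))
                                                       (cong (E (i kB) ∘ i) τ-kB))))))

    module Loop (σ-injective : ∀ {x y} → σ x ≡ σ y → x ≡ y) (σkB≡kA : σ kB ≡ kA) where

      ρ₂ : Fin (suc n) → Fin (suc n)
      ρ₂ = removeAt σ kA

      punchIn-ρ₂-k : punchIn kA (ρ₂ k) ≡ σ kA
      punchIn-ρ₂-k = punchIn-removeAt-bypass σ kA k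
        (trans (cong σ (punchIn-inject₁-self k)) σkB≡kA)
        (λ σkA≡kA → punchInᵢ≢i kB k
           (trans (punchIn-suc-self k) (σ-injective (trans σkA≡kA (sym σkB≡kA)))))

      punchIn-ρ₂ : ∀ z → punchIn kA (ρ₂ (punchIn k z)) ≡ σ (out z)
      punchIn-ρ₂ z = trans (punchIn-removeAt σ kA (punchIn k z) σout≢kA)
                           (cong σ (sym (out≡punchIn-kA z)))
        where
        σout≢kA : σ (punchIn kA (punchIn k z)) ≢ kA
        σout≢kA σout≡kA = punchInᵢ≢i kB (punchIn k z)
          (σ-injective (trans (cong σ (out≡punchIn-kA z)) (trans σout≡kA (sym σkB≡kA))))

      slot′ : (Fin (suc n) → Fin N) → Carrier → Carrier
      slot′ i x = prodOrd (suc n) (insertAt (λ z → edge ρ₂ i (punchIn k z)) k x)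

      slot-insertAt : ∀ i a {x y} → x ≈ y → slot (insertAt i kA a) x ≈ slot′ i y
      slot-insertAt i a = prodOrd-insertAt-cong n k (λ z → reflexive (cong₂ E
        (trans (cong (insertAt i kA a) (out≡punchIn-kA z)) (insertAt-punchIn i kA a (punchIn k z)))
        (trans (cong (insertAt i kA a) (sym (punchIn-ρ₂ z)))
               (insertAt-punchIn i kA a (ρ₂ (punchIn k z))))))

      insertAt-kB : ∀ (i : Fin (suc n) → Fin N) a → insertAt i kA a kB ≡ i k
      insertAt-kB i a = trans (cong (insertAt i kA a) (sym (punchIn-inject₁-self k)))
                              (insertAt-punchIn i kA a k)

      insertAt-σkA : ∀ (i : Fin (suc n) → Fin N) a → insertAt i kA a (σ kA) ≡ i (ρ₂ k)
      insertAt-σkA i a = trans (cong (insertAt i kA a) (sym punchIn-ρ₂-k))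
                               (insertAt-punchIn i kA a (ρ₂ k))

      sum-term₂≈natMul : sumAssign m term₂ ≈ natMul N (w E ρ₂)
      sum-term₂≈natMul = begin
        sumAssign m term₂
          ≈⟨ sumAssign-insertAt (suc n) kA term₂ (term-ext _ _ _ _) ⟩
        ∑[ a < N ] sumAssign (suc n) (λ i → term₂ (insertAt i kA a))
          ≈⟨ sum-cong-≋ (λ a → sumAssign-cong (suc n) (λ i → free-of-kA i a)) ⟩
        ∑[ a < N ] sumAssign (suc n) (monomial ρ₂)
          ≈⟨ sum-const N (w E ρ₂) ⟩
        natMul N (w E ρ₂)
          ∎
        where
        free-of-kA : ∀ i a → term₂ (insertAt i kA a) ≈ monomial ρ₂ i
        free-of-kA i a = let ι = insertAt i kA a in begin
          term₂ (insertAt i kA a)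
            ≈⟨ *-cong (≈-trans (reflexive (cong (λ u → δ (ι u) (ι kA)) σkB≡kA)) (δ-refl (ι kA)))
                      (slot-insertAt i a (reflexive (cong₂ E (insertAt-kB i a) (insertAt-σkA i a)))) ⟩
          1# * slot′ i (edge ρ₂ i k)
            ≈⟨ *-identityˡ (slot′ i (edge ρ₂ i k)) ⟩
          slot′ i (edge ρ₂ i k)
            ≈⟨ prodOrd≈insertAt n k (edge ρ₂ i) (λ _ → ≈-refl) ≈-refl ⟨
          monomial ρ₂ i
            ∎

      sum-term₁≈trace : σ kA ≢ kB → sumAssign m term₁ ≈ trace * w E (removeAt ρ₂ k)
      sum-term₁≈trace σkA≢kB = begin
        sumAssign m term₁
          ≈⟨ sumAssign-insertAt (suc n) kA term₁ (term-ext _ _ _ _) ⟩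
        ∑[ a < N ] sumAssign (suc n) (λ i → term₁ (insertAt i kA a))
          ≈⟨ sum-cong-≋ (λ a → sumAssign-cong (suc n) (λ i → loop i a)) ⟩
        ∑[ a < N ] sumAssign (suc n) (λ i → d i * slot′ i (E a a))
          ≈⟨ sum-sumAssign-comm (suc n) (λ a i → d i * slot′ i (E a a)) ⟩
        sumAssign (suc n) (λ i → ∑[ a < N ] (d i * slot′ i (E a a)))
          ≈⟨ sumAssign-cong (suc n) traced ⟩
        sumAssign (suc n) (λ i → trace * (d i * P i))
          ≈⟨ sumAssign-*ˡ (suc n) trace (λ i → d i * P i) ⟩
        trace * sumAssign (suc n) (λ i → d i * P i)
          ≈⟨ *-congˡ (w-removeAt n ρ₂ k ρ₂k≢k) ⟩
        trace * w E (removeAt ρ₂ k)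
          ∎
        where
        ρ₂k≢k : ρ₂ k ≢ k
        ρ₂k≢k ρ₂k≡k = σkA≢kB (trans (sym punchIn-ρ₂-k)
                                    (trans (cong (punchIn kA) ρ₂k≡k) (punchIn-inject₁-self k)))

        d : (Fin (suc n) → Fin N) → Carrier
        d i = δ (i (ρ₂ k)) (i k)

        P : (Fin (suc n) → Fin N) → Carrier
        P i = prodOrd n (λ z → edge ρ₂ i (punchIn k z))

        loop : ∀ i a → term₁ (insertAt i kA a) ≈ d i * slot′ i (E a a)
        loop i a = *-cong (reflexive (cong₂ δ (insertAt-σkA i a) (insertAt-kB i a)))
          (slot-insertAt i a (reflexive (cong₂ E (insertAt-lookup i kA a)
            (trans (cong (insertAt i kA a) σkB≡kA) (insertAt-lookup i kA a)))))

        traced : ∀ i → ∑[ a < N ] (d i * slot′ i (E a a)) ≈ trace * (d i * P i)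
        traced i = begin
          ∑[ a < N ] (d i * slot′ i (E a a))
            ≈⟨ *-distribˡ-sum (d i) (λ a → slot′ i (E a a)) ⟨
          d i * ∑[ a < N ] slot′ i (E a a)
            ≈⟨ *-congˡ (sandwich-sum (prodOrd-insertAt-sandwich n _ k) (λ a → E a a)) ⟨
          d i * slot′ i trace
            ≈⟨ *-congˡ (prodOrd-insertAt-commuting n _ k trace (λ _ → trace-commutes _ _)) ⟩
          d i * (trace * P i) ≈⟨ *-assoc (d i) trace (P i) ⟨
          d i * trace * P i   ≈⟨ *-congʳ (δ-central (i (ρ₂ k)) (i k) trace) ⟩
          trace * d i * P i   ≈⟨ *-assoc trace (d i) (P i) ⟩
          trace * (d i * P i) ∎

  w-recurrence : Part4a E
  w-recurrence n σ k σkA≢kB σkB≢kA =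
    ≈-trans w-sub-w-conjugate (+-cong (sum-term₁ σkA≢kB) (-‿cong (sum-term₂ σkB≢kA)))
    where open Adjacent (σ ⟨$⟩ʳ_) k

  w-recurrence-loop : Part4b E
  w-recurrence-loop n σ k σkB≡kA _ _ _ σkA≢kB =
    ≈-trans w-sub-w-conjugate
            (+-cong (≈-trans (sum-term₁≈trace σkA≢kB) (*-congʳ (≈-sym C₁≈trace)))
                    (-‿cong sum-term₂≈natMul))
    where
    open Adjacent (σ ⟨$⟩ʳ_) k
    open Loop (Injection.injective (↔⇒↣ σ)) σkB≡kA

-- The identities hold for every N.
mainTheorem1 : ∀ {c ℓ : Level} (R : Ring c ℓ) (N : ℕ) → 1 ≤ N →
    (E : Fin N → Fin N → Ring.Carrier R) → GL.IsGLFamily R N E →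
    GL.Theorem R N E
mainTheorem1 R N _ E gl = w-empty , w-concat , w-cycle , w-recurrence , w-recurrence-loop
  where open Words R N E gl
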